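{- Let $\mathcal M=(Q,\delta,I)$ be a $k$-nested multi-counter system, $c\in C_0$ a configuration and $q\in Q$ a state. It is decidable whether there is a configuration $c'\in C_0$ with $c\preceq c'$ and $(q,\emptyset)\to^* c'$.
   Context: A $k$-nested multi-counter system ($k$-nMCS) is $\mathcal M=(Q,\delta,I)$ with a finite set $Q$ of states, initial states $I\subseteq Q$ and a finite transition relation $\delta$ consisting of pairs $((q_0,\dots,q_i),(q_0',\dots,q_k'))$ with $0\le i\le k$ and all $q_j,q_j'\in Q$. Configurations of level $i$ are defined by $C_k=Q$ and $C_{i-1}=Q\times\mathbb N^{C_i}$ (a state together with a finite multiset of level-$i$ configurations), for $i=k,\dots,1$; the configurations of $\mathcal M$ are $C_0$, and $(q,\emptyset)$ denotes the level-0 configuration with state $q$ and empty multiset. Transition relation $\to$: for $((q_0,\dots,q_i),(q_0',\dots,q_k'))\in\delta$, a configuration $c$ with root state $q_0$ in which one can pick a chain $e_1\in M_0$ of state $q_1$, $e_2$ in the multiset of $e_1$ of state $q_2$, …, $e_i$ of state $q_i$ (where $M_0$ is the multiset of $c$; each $e_j$ for $j<k$ is a pair state/multiset and $e_k\in Q$) steps to the configuration obtained by replacing the root state by $q_0'$ and the state of each $e_j$ ($1\le j\le i$, one occurrence each) by $q_j'$, and, if $i<k$, adding to the multiset of $e_i$ (of the root if $i=0$) one new element $(q_{i+1}',\{(q_{i+2}',\{\cdots\{q_k'\}\cdots\})\})$. In term notation: $(q_0,X_1+q_1(X_2+\cdots q_i(X_{i+1})\cdots))\to(q_0',X_1+q_1'(X_2+\cdots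 q_i'(X_{i+1}+q_{i+1}'(q_{i+2}'\cdots q_{k-1}'(q_k')))))$. $\to^*$ is its reflexive-transitive closure. Order: on $C_k=Q$, $\preceq$ is equality; for $(p,M),(p',M')\in C_{i-1}$, $(p,M)\preceq(p',M')$ iff $p=p'$ and there is an injection $h$ from the elements of $M$ (counted with multiplicity) into the elements of $M'$ with $b\preceq h(b)$ for all $b$. -}

module Defs where

open import Data.Nat using (ℕ; zero; suc)
open import Data.Fin using (Fin; toℕ)
open import Data.List using (List; []; _∷_; _++_; length; lookup)
open import Data.Vec using (Vec; []; _∷_; toList)
open import Data.Product using (Σ; _×_; _,_; ∃)
open import Data.List.Membership.Propositional using (_∈_)
open import Relation.Binary.PropositionalEquality using (_≡_)
open import Relation.Binary.Construct.Closure.ReflexiveTransitive using (Star)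

-- Configurations with d remaining nesting levels below:
--   Cfg n 0       = Q                       (this is C_k)
--   Cfg n (suc d) = Q × (finite multiset of Cfg n d)
-- A level-0 configuration of a k-nMCS is an element of Cfg n k (= C_0).
-- Finite multisets are represented by lists; all notions below (picking an
-- element, the order ⪯) are insensitive to the order of list entries.
Cfg : ℕ → ℕ → Set
Cfg n zero    = Fin n
Cfg n (suc d) = Fin n × List (Cfg n d)

init : ∀ {n} k → Fin n → Cfg n k
init zero    q = q
init (suc k) q = q , []

-- A transition ((q_0,…,q_i),(q_0',…,q_k')) with 0 ≤ i ≤ k.
record Transition (k n : ℕ) : Set where
  field
    i   : Fin (suc k)
    lhs : Vec (Fin n) (suc (toℕ i))
    rhs : Vec (Fin n) (suc k)

record NMCS (k n : ℕ) : Set where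
  field
    δ : List (Transition k n)
    I : List (Fin n)

-- The new element q_{i+1}'(q_{i+2}'(⋯ q_k')) built from the remaining states.
chain : ∀ {n} d → Vec (Fin n) (suc d) → Cfg n d
chain zero    (q ∷ [])     = q
chain (suc d) (q ∷ q' ∷ r) = q , (chain d (q' ∷ r) ∷ [])

-- Fire d ls rs c c' : firing the transition with left part ls and right part rs
-- (rs has one state per level from the current one down to level k) on c gives c'.
data Fire {n : ℕ} : (d : ℕ) → List (Fin n) → Vec (Fin n) (suc d) → Cfg n d → Cfg n d → Set where
  -- i = k : the chain ends at a leaf state
  leaf : ∀ {q q'} → Fire zero (q ∷ []) (q' ∷ []) q q'
  -- i < k : the chain ends here; add the new element to this multiset
  add  : ∀ {d q q' r M} →
         Fire (suc d) (q ∷ []) (q' ∷ r) (q , M) (q' , chain d r ∷ M)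
  down : ∀ {d q q1 q' ls r xs ys e e'} →
         Fire d (q1 ∷ ls) r e e' →
         Fire (suc d) (q ∷ q1 ∷ ls) (q' ∷ r) (q , xs ++ e ∷ ys) (q' , xs ++ e' ∷ ys)

Step : ∀ {k n} → NMCS k n → Cfg n k → Cfg n k → Set
Step {k} {n} M c c' =
  Σ (Transition k n) λ t → (t ∈ NMCS.δ M) ×
    Fire k (toList (Transition.lhs t)) (Transition.rhs t) c c'

Reach : ∀ {k n} → NMCS k n → Cfg n k → Cfg n k → Set
Reach M = Star (Step M)

_⪯_ : ∀ {n d} → Cfg n d → Cfg n d → Set
_⪯_ {d = zero}  p q = p ≡ q
_⪯_ {d = suc d} (p , M) (p' , M') =
  p ≡ p' × Σ (Fin (length M) → Fin (length M')) λ h →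
    (∀ {a b} → h a ≡ h b → a ≡ b) × (∀ a → lookup M a ⪯ lookup M' (h a))

-- The backward algorithm for well-structured transition systems decides
-- coverability. Configurations are well-quasi-ordered in the constructive
-- sense of almost-full relations: equality of states is almost full, almost
-- fullness is preserved by intersection (intuitionistic Ramsey) and by
-- embedding of finite multisets, so every level C_i is almost full. Firing a
-- transition is monotone, and for each transition the configurations that can
-- reach the upward closure of b have a computable finite basis. Starting from
-- {c} and adding uncovered predecessors produces a bad sequence, so it stops;
-- the result is a finite basis of the configurations from which c can be
-- covered, and membership in its upward closure is decidable.

module Submission where

open import Defs
open import Level using (0ℓ)
open import Data.Empty using (⊥; ⊥-elim)
open import Data.Fin using (Fin; zero; suc; _≟_)
open import Data.Fin.Properties using (suc-injective)
open import Data.List using (List; []; _∷_; _++_; length; lookup; removeAt; map; concatMap)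
open import Data.List.Membership.Propositional using (_∈_)
open import Data.List.Membership.Propositional.Properties using (∈-map⁺)
open import Data.List.Relation.Unary.All as All using (All; []; _∷_; all?; lookupAny)
import Data.List.Relation.Unary.All.Properties as All
open import Data.List.Relation.Unary.All.Properties using (¬All⇒Any¬; ¬Any⇒All¬)
open import Data.List.Relation.Unary.Any as Any using (Any; here; there; any?)
import Data.List.Relation.Unary.Any.Properties as Any
open import Data.Nat using (ℕ; zero; suc; _≤_; z≤n; s≤s; _≤?_)
open import Data.Nat.Properties using (≰⇒>; ≤-trans)
open import Data.Product using (Σ; _×_; _,_; proj₁; proj₂; ∃; ∃₂; ∃-syntax)
open import Data.Sum using (_⊎_; inj₁; inj₂; [_,_]′; swap)
open import Data.Sum.Relation.Binary.Pointwise using (Pointwise; inj₁; inj₂)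
open import Data.Unit using (⊤; tt)
open import Data.Vec using (Vec; []; _∷_; toList)
open import Function using (_∘_; _on_)
open import Function.Bundles using (_⇔_; mk⇔)
import Function.Properties.Equivalence as ⇔
open import Induction.WellFounded using (Acc; acc; acc-inverse)
open import Relation.Binary.Core using (Rel; _⇒_)
open import Relation.Binary.Definitions using (Reflexive; Transitive; Decidable)
open import Relation.Binary.Construct.Closure.ReflexiveTransitive using (Star; ε; _◅_)
open import Relation.Binary.Construct.Intersection using (_∩_)
open import Relation.Binary.PropositionalEquality
  using (_≡_; _≢_; refl; sym; trans; cong; subst; module ≡-Reasoning)
open import Relation.Nullary using (Dec; yes; no; ¬_)
open import Relation.Nullary.Decidable using (_×-dec_; _⊎-dec_; map′)
import Relation.Nullary.Decidable as Dec

-- Almost-full relations (Vytiniotis, Coquand and Wahlstedt), the inductive form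
-- of well-quasi-orders; R ↑ x also accepts every pair whose first component
-- lies R-above x.
_↑_ : ∀ {A : Set} → Rel A 0ℓ → A → Rel A 0ℓ
(R ↑ x) y z = R y z ⊎ R x y

data AF {A : Set} : Rel A 0ℓ → Set₁ where
  now   : ∀ {R} → (∀ x y → R x y) → AF R
  later : ∀ {R} → (∀ x → AF (R ↑ x)) → AF R

module _ {A : Set} where

  af-mono : {R S : Rel A 0ℓ} → R ⇒ S → AF R → AF S
  af-mono R⇒S (now f)   = now λ x y → R⇒S (f x y)
  af-mono R⇒S (later g) = later λ x → af-mono [ (λ r → inj₁ (R⇒S r)) , (λ r → inj₂ (R⇒S r)) ]′ (g x)

  af-↑ : {R : Rel A 0ℓ} → AF R → ∀ x → AF (R ↑ x)
  af-↑ (now f)   x = now λ y z → inj₁ (f y z)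
  af-↑ (later g) x = g x

  private
    pair : {R P Q : Set} → R ⊎ P → R ⊎ Q → R ⊎ (P × Q)
    pair (inj₁ r) _        = inj₁ r
    pair (inj₂ p) (inj₁ r) = inj₁ r
    pair (inj₂ p) (inj₂ q) = inj₂ (p , q)

    assoc-swap : {X Y Z : Set} → (X ⊎ Y) ⊎ Z → (X ⊎ Z) ⊎ Y
    assoc-swap = [ [ (λ x → inj₁ (inj₁ x)) , inj₂ ]′ , (λ z → inj₁ (inj₂ z)) ]′

    medial : {W X Y Z : Set} → ((W ⊎ X) ⊎ Y) ⊎ Z → (W ⊎ Y) ⊎ (X ⊎ Z)
    medial = [ [ [ (λ w → inj₁ (inj₁ w)) , (λ x → inj₂ (inj₁ x)) ]′ , (λ y → inj₁ (inj₂ y)) ]′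
             , (λ z → inj₂ (inj₂ z)) ]′

    lift-side : ∀ {R S P : Rel A 0ℓ} {x} → (∀ y z → S y z → R y z ⊎ P y z) →
                ∀ y z → (S ↑ x) y z → ((R ↑ x) y z ⊎ P x y) ⊎ P y z
    lift-side i _ _ (inj₁ s) = [ (λ r → inj₁ (inj₁ (inj₁ r))) , inj₂ ]′ (i _ _ s)
    lift-side i _ _ (inj₂ s) = [ (λ r → inj₁ (inj₁ (inj₂ r))) , (λ p → inj₁ (inj₂ p)) ]′ (i _ _ s)

    keep-side : ∀ {R S P T : Rel A 0ℓ} {x} → (∀ y z → S y z → R y z ⊎ P y z) →
                ∀ y z → S y z → ((R ↑ x) y z ⊎ T y z) ⊎ P y z
    keep-side i _ _ s = [ (λ r → inj₁ (inj₁ (inj₁ r))) , inj₂ ]′ (i _ _ s)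

  -- The intuitionistic Ramsey theorem, by the proof of Vytiniotis, Coquand and
  -- Wahlstedt: lifting at x turns the residue P x y × Q x y of a binary side
  -- condition into a unary one in y, and a unary one into a nullary one.
  af-∪-nullary : {R S₁ S₂ : Rel A 0ℓ} {P Q : Set} → AF S₁ → AF S₂ →
                 (∀ x y → S₁ x y → R x y ⊎ P) → (∀ x y → S₂ x y → R x y ⊎ Q) →
                 AF (λ x y → R x y ⊎ (P × Q))
  af-∪-nullary (now f) af₂ i₁ i₂ = af-mono (λ s → pair (i₁ _ _ (f _ _)) (i₂ _ _ s)) af₂
  af-∪-nullary {R} (later g) af₂ i₁ i₂ = later λ x →
    af-mono distrib (af-∪-nullary (g x) (af-↑ af₂ x) (lift i₁) (lift i₂))
    where
    lift : ∀ {S} {T : Set} {x} → (∀ y z → S y z → R y z ⊎ T) →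
           ∀ y z → (S ↑ x) y z → (R ↑ x) y z ⊎ T
    lift i _ _ (inj₁ s) = [ (λ r → inj₁ (inj₁ r)) , inj₂ ]′ (i _ _ s)
    lift i _ _ (inj₂ s) = [ (λ r → inj₁ (inj₂ r)) , inj₂ ]′ (i _ _ s)
    distrib : {X Y Z : Set} → (X ⊎ Y) ⊎ Z → (X ⊎ Z) ⊎ (Y ⊎ Z)
    distrib = [ [ (λ x → inj₁ (inj₁ x)) , (λ y → inj₂ (inj₁ y)) ]′ , (λ z → inj₁ (inj₂ z)) ]′

  af-∪-unary : {R S₁ S₂ : Rel A 0ℓ} {P Q : A → Set} → AF S₁ → AF S₂ →
               (∀ x y → S₁ x y → R x y ⊎ P x) → (∀ x y → S₂ x y → R x y ⊎ Q x) →
               AF (λ x y → R x y ⊎ (P x × Q x))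
  af-∪-unary (now f) af₂ i₁ i₂ = af-mono (λ s → pair (i₁ _ _ (f _ _)) (i₂ _ _ s)) af₂
  af-∪-unary af₁ (now f) i₁ i₂ = af-mono (λ s → pair (i₁ _ _ s) (i₂ _ _ (f _ _))) af₁
  af-∪-unary af₁@(later g) af₂@(later h) i₁ i₂ = later λ x →
    af-mono medial (af-∪-nullary (af-∪-unary (g x) af₂ (lift-side i₁) (keep-side i₂))
                                 (af-∪-unary af₁ (h x) (keep-side i₁) (lift-side i₂))
                                 (λ _ _ → assoc-swap) (λ _ _ → assoc-swap))

  af-∪-binary : {R S₁ S₂ P Q : Rel A 0ℓ} → AF S₁ → AF S₂ →
                (∀ x y → S₁ x y → R x y ⊎ P x y) → (∀ x y → S₂ x y → R x y ⊎ Q x y) →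
                AF (λ x y → R x y ⊎ (P x y × Q x y))
  af-∪-binary (now f) af₂ i₁ i₂ = af-mono (λ s → pair (i₁ _ _ (f _ _)) (i₂ _ _ s)) af₂
  af-∪-binary af₁ (now f) i₁ i₂ = af-mono (λ s → pair (i₁ _ _ s) (i₂ _ _ (f _ _))) af₁
  af-∪-binary af₁@(later g) af₂@(later h) i₁ i₂ = later λ x →
    af-mono medial (af-∪-unary (af-∪-binary (g x) af₂ (lift-side i₁) (keep-side i₂))
                               (af-∪-binary af₁ (h x) (keep-side i₁) (lift-side i₂))
                               (λ _ _ → assoc-swap) (λ _ _ → assoc-swap))

  af-∩ : {R S : Rel A 0ℓ} → AF R → AF S → AF (R ∩ S)
  af-∩ afR afS =
    af-mono [ (λ ()) , (λ rs → rs) ]′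
            (af-∪-binary {R = λ _ _ → ⊥} afR afS (λ _ _ → inj₂) (λ _ _ → inj₂))

af-on : ∀ {A B : Set} {R : Rel B 0ℓ} (f : A → B) → AF R → AF (R on f)
af-on f (now h)   = now λ x y → h (f x) (f y)
af-on f (later g) = later λ x → af-on f (g (f x))

module _ {A B : Set} where

  OnLeft : Rel A 0ℓ → Rel (A ⊎ B) 0ℓ
  OnLeft S (inj₁ a) (inj₁ b) = S a b
  OnLeft S (inj₁ a) (inj₂ b) = ⊥
  OnLeft S (inj₂ b) v        = ⊤

  af-OnLeft : {S : Rel A 0ℓ} → AF S → AF (OnLeft S)
  af-OnLeft (now f) = later λ
    { (inj₁ a) → now λ { (inj₁ c) _ → inj₂ (f a c) ; (inj₂ _) _ → inj₁ tt }
    ; (inj₂ _) → now λ _ _ → inj₂ tt }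
  af-OnLeft {S} (later g) = later λ
    { (inj₁ a) → af-mono (λ {u} {v} → lift a u v) (af-OnLeft (g a))
    ; (inj₂ _) → now λ _ _ → inj₂ tt }
    where
    lift : ∀ a u v → OnLeft (S ↑ a) u v → (OnLeft S ↑ inj₁ a) u v
    lift a (inj₁ _) (inj₁ _) (inj₁ s) = inj₁ s
    lift a (inj₁ _) (inj₁ _) (inj₂ s) = inj₂ s
    lift a (inj₂ _) _        _        = inj₁ tt

af-⊎ : ∀ {A B : Set} {R : Rel A 0ℓ} {S : Rel B 0ℓ} → AF R → AF S → AF (Pointwise R S)
af-⊎ {R = R} {S} afR afS =
  af-mono (λ {u} {v} → both u v) (af-∩ (af-OnLeft afR) (af-on swap (af-OnLeft afS)))
  where
  both : ∀ u v → OnLeft R u v × OnLeft S (swap u) (swap v) → Pointwise R S u v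
  both (inj₁ _) (inj₁ _) (r , _) = inj₁ r
  both (inj₂ _) (inj₂ _) (_ , s) = inj₂ s
  both (inj₁ _) (inj₂ _) (() , _)
  both (inj₂ _) (inj₁ _) (_ , ())

af-Fin : ∀ n → AF {Fin n} _≡_
af-Fin zero    = now λ ()
af-Fin (suc n) = af-mono (λ {x} {y} → unsplit x y) (af-on split (af-⊎ {⊤} af-⊤ (af-Fin n)))
  where
  af-⊤ : AF {⊤} _≡_
  af-⊤ = now λ _ _ → refl
  split : Fin (suc n) → ⊤ ⊎ Fin n
  split zero    = inj₁ tt
  split (suc i) = inj₂ i
  unsplit : ∀ x y → Pointwise _≡_ _≡_ (split x) (split y) → x ≡ y
  unsplit zero    zero    _            = refl
  unsplit (suc x) (suc y) (inj₂ refl) = refl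

af-≤-above : ∀ m → AF (λ a b → a ≤ b ⊎ m ≤ a)
af-≤-above zero    = now λ _ _ → inj₂ z≤n
af-≤-above (suc m) = later lift
  where
  lift : ∀ x → AF ((λ a b → a ≤ b ⊎ suc m ≤ a) ↑ x)
  lift x with x ≤? m
  ... | yes x≤m = af-mono [ (λ a≤b → inj₁ (inj₁ a≤b)) , (λ m≤a → inj₂ (inj₁ (≤-trans x≤m m≤a))) ]′
                          (af-≤-above m)
  ... | no  x≰m = now λ _ _ → inj₂ (inj₂ (≰⇒> x≰m))

af-≤ : AF _≤_
af-≤ = later af-≤-above

data Pick {A : Set} : A → List A → List A → Set where
  here  : ∀ {x xs} → Pick x (x ∷ xs) xs
  there : ∀ {x y xs ys} → Pick x xs ys → Pick x (y ∷ xs) (y ∷ ys)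

data Emb {A : Set} (R : Rel A 0ℓ) : Rel (List A) 0ℓ where
  []   : ∀ {ys} → Emb R [] ys
  cons : ∀ {x y xs ys ys′} → R x y → Pick y ys ys′ → Emb R xs ys′ → Emb R (x ∷ xs) ys

module _ {A : Set} where

  pick-swap : ∀ {a b : A} {X Y Z} → Pick a X Y → Pick b Y Z → ∃[ W ] Pick b X W × Pick a W Z
  pick-swap here      p         = _ , there p , here
  pick-swap (there p) here      = _ , here , p
  pick-swap (there p) (there q) with pick-swap p q
  ... | _ , q′ , p′ = _ , there q′ , there p′

  pick-compare : ∀ {y z : A} {Z Z₁ Z₂} → Pick y Z Z₁ → Pick z Z Z₂ →
                 (y ≡ z × Z₁ ≡ Z₂) ⊎ ∃[ W ] Pick y Z₂ W × Pick z Z₁ W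
  pick-compare here      here      = inj₁ (refl , refl)
  pick-compare here      (there q) = inj₂ (_ , here , q)
  pick-compare (there p) here      = inj₂ (_ , p , here)
  pick-compare (there p) (there q) with pick-compare p q
  ... | inj₁ (refl , refl)  = inj₁ (refl , refl)
  ... | inj₂ (_ , p′ , q′) = inj₂ (_ , there p′ , there q′)

  pick-++ : ∀ (xs : List A) {y ys} → Pick y (xs ++ y ∷ ys) (xs ++ ys)
  pick-++ []       = here
  pick-++ (x ∷ xs) = there (pick-++ xs)

  pick⇒++ : ∀ {y : A} {Y Y′} → Pick y Y Y′ → ∃₂ λ xs ys → Y ≡ xs ++ y ∷ ys × Y′ ≡ xs ++ ys
  pick⇒++ here = [] , _ , refl , refl
  pick⇒++ (there {y = z} p) with pick⇒++ p
  ... | xs , ys , refl , refl = z ∷ xs , ys , refl , refl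

  any⇒pick : ∀ {P : A → Set} {Y} → Any P Y → ∃₂ λ y Y′ → Pick y Y Y′ × P y
  any⇒pick (here py) = _ , _ , here , py
  any⇒pick (there a) with any⇒pick a
  ... | y , Y′ , p , py = y , _ , there p , py

  pick? : (P : A → List A → Set) → (∀ y Y′ → Dec (P y Y′)) →
          ∀ Y → Dec (∃₂ λ y Y′ → Pick y Y Y′ × P y Y′)
  pick? P P? [] = no λ { (_ , _ , () , _) }
  pick? P P? (z ∷ Z) with P? z Z | pick? (λ y Y′ → P y (z ∷ Y′)) (λ y Y′ → P? y (z ∷ Y′)) Z
  ... | yes pz | _                       = yes (z , Z , here , pz)
  ... | no _   | yes (y , Y′ , p , py) = yes (y , z ∷ Y′ , there p , py)
  ... | no ¬pz | no ¬rest                = no λ { (_ , _ , here , pz)    → ¬pz pz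
                                               ; (y , _ , there p , py) → ¬rest (y , _ , p , py) }

module _ {A : Set} {R : Rel A 0ℓ} where

  emb-skip : ∀ {X Y} {z : A} → Emb R X Y → Emb R X (z ∷ Y)
  emb-skip []           = []
  emb-skip (cons r p e) = cons r (there p) (emb-skip e)

  emb-refl : Reflexive R → Reflexive (Emb R)
  emb-refl R-refl {[]}    = []
  emb-refl R-refl {x ∷ X} = cons R-refl here (emb-refl R-refl)

  emb-pick : ∀ {y : A} {Y Y′ Z} → Emb R Y Z → Pick y Y Y′ →
             ∃₂ λ z Z′ → Pick z Z Z′ × R y z × Emb R Y′ Z′
  emb-pick (cons r p e) here = _ , _ , p , r , e
  emb-pick (cons r p e) (there q) with emb-pick e q
  ... | z , _ , p₂ , r₂ , e₂ with pick-swap p p₂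
  ...   | _ , p₃ , p₄ = z , _ , p₃ , r₂ , cons r p₄ e₂

  emb-insert : ∀ {z w : A} {Z Z′ W W′} → Pick z Z Z′ → R z w → Pick w W W′ → Emb R Z′ W′ → Emb R Z W
  emb-insert here      r q e              = cons r q e
  emb-insert (there p) r q (cons r′ q′ e) with pick-swap q q′
  ... | _ , q₁ , q₂ = cons r′ q₁ (emb-insert p r q₂ e)

  emb-split : ∀ {z : A} {X Z Z′} → Pick z Z Z′ → Emb R X Z →
              Emb R X Z′ ⊎ ∃₂ λ x X′ → Pick x X X′ × R x z × Emb R X′ Z′
  emb-split q [] = inj₁ []
  emb-split q (cons r p e) with pick-compare p q
  ... | inj₁ (refl , refl)   = inj₂ (_ , _ , here , r , e)
  ... | inj₂ (_ , p′ , q′) with emb-split q′ e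
  ...   | inj₁ e′                    = inj₁ (cons r p′ e′)
  ...   | inj₂ (x , _ , p″ , r′ , e′) = inj₂ (x , _ , there p″ , r′ , cons r p′ e′)

  emb-trans : Transitive R → Transitive (Emb R)
  emb-trans R-trans []           e₂ = []
  emb-trans R-trans (cons r p e) e₂ with emb-pick e₂ p
  ... | _ , _ , p′ , r′ , e′ = cons (R-trans r r′) p′ (emb-trans R-trans e e′)

  emb? : Decidable R → Decidable (Emb R)
  emb? R? []      Y = yes []
  emb? R? (x ∷ X) Y =
    map′ (λ { (_ , _ , p , r , e) → cons r p e }) (λ { (cons r p e) → _ , _ , p , r , e })
         (pick? (λ y Y′ → R x y × Emb R X Y′) (λ y Y′ → R? x y ×-dec emb? R? X Y′) Y)

  emb-length : (∀ x y → R x y) → ∀ {X Y} → length X ≤ length Y → Emb R X Y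
  emb-length total {[]}              _       = []
  emb-length total {x ∷ X} {y ∷ Y} (s≤s n) = cons (total x y) here (emb-length total n)

emb-map-All : ∀ {A : Set} {R S : Rel A 0ℓ} {X Y} → Emb R X Y → All (λ x → ∀ {y} → R x y → S x y) X →
              Emb S X Y
emb-map-All []           []       = []
emb-map-All (cons r p e) (f ∷ fs) = cons (f r) p (emb-map-All e fs)

module _ {A : Set} where

  ↑? : {R : Rel A 0ℓ} → Decidable R → ∀ z → Decidable (R ↑ z)
  ↑? R? z x y = R? x y ⊎-dec R? z x

  af-Emb : {R : Rel A 0ℓ} → Decidable R → AF R → AF (Emb R)
  af-Emb R? (now total) = af-mono (emb-length total) (af-on length af-≤)
  af-Emb {R} R? afR@(later g) = later lift
    where
    lift : ∀ M → AF (Emb R ↑ M)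
    lift []       = now λ _ _ → inj₂ []
    lift (x ∷ M′) =
      af-mono (λ {N} {N′} → back N N′ (split N) (split N′))
        (af-on (λ N → forget (split N))
          (af-⊎ (af-Emb (↑? R? x) (g x)) (af-∩ (af-on proj₁ afR) (af-on proj₂ (lift M′)))))
      where
      -- Split N by whether some element of N is R-above x. If none is, R ↑ x
      -- agrees with R on N, and Emb (R ↑ x) is almost full by the smaller proof
      -- g x; otherwise compare the chosen elements by R and the rests by Emb R ↑ M′.
      Split : List A → Set
      Split N = All (¬_ ∘ R x) N ⊎ ∃₂ λ a L → Pick a N L × R x a

      split : ∀ N → Split N
      split N with any? (R? x) N
      ... | yes above = inj₂ (any⇒pick above)
      ... | no ¬above = inj₁ (¬Any⇒All¬ N ¬above)

      forget : ∀ {N} → Split N → List A ⊎ (A × List A)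
      forget {N} (inj₁ _)              = inj₁ N
      forget     (inj₂ (a , L , _ , _)) = inj₂ (a , L)

      back : ∀ N N′ (s : Split N) (s′ : Split N′) →
             Pointwise (Emb (R ↑ x)) ((R on proj₁) ∩ ((Emb R ↑ M′) on proj₂)) (forget s) (forget s′) →
             (Emb R ↑ (x ∷ M′)) N N′
      back N N′ (inj₁ ¬above) (inj₁ _) (inj₁ e) = inj₁ (emb-map-All e (All.map collapse ¬above))
        where
        collapse : ∀ {a} → ¬ R x a → ∀ {b} → (R ↑ x) a b → R a b
        collapse ¬rxa (inj₁ r)   = r
        collapse ¬rxa (inj₂ rxa) = ⊥-elim (¬rxa rxa)
      back N N′ (inj₂ (_ , _ , p , _))   (inj₂ (_ , _ , p′ , _)) (inj₂ (r , inj₁ e)) =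
        inj₁ (emb-insert p r p′ e)
      back N N′ (inj₂ (_ , _ , p , rxa)) (inj₂ _)                 (inj₂ (_ , inj₂ e)) =
        inj₂ (cons rxa p e)

IndexEmb : {A : Set} → Rel A 0ℓ → Rel (List A) 0ℓ
IndexEmb R X Y = Σ (Fin (length X) → Fin (length Y)) λ h →
  (∀ {a b} → h a ≡ h b → a ≡ b) × (∀ a → R (lookup X a) (lookup Y (h a)))

module _ {A : Set} where

  pick-index : ∀ {y : A} {Y Y′} → Pick y Y Y′ → Fin (length Y)
  pick-index here      = zero
  pick-index (there p) = suc (pick-index p)

  -- punchIn (pick-index p), without casting length Y to suc (length Y′).
  skip : ∀ {y : A} {Y Y′} → Pick y Y Y′ → Fin (length Y′) → Fin (length Y)
  skip here      i       = suc i
  skip (there p) zero    = zero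
  skip (there p) (suc i) = suc (skip p i)

  lookup-pick-index : ∀ {y : A} {Y Y′} (p : Pick y Y Y′) → lookup Y (pick-index p) ≡ y
  lookup-pick-index here      = refl
  lookup-pick-index (there p) = lookup-pick-index p

  lookup-skip : ∀ {y : A} {Y Y′} (p : Pick y Y Y′) i → lookup Y (skip p i) ≡ lookup Y′ i
  lookup-skip here      i       = refl
  lookup-skip (there p) zero    = refl
  lookup-skip (there p) (suc i) = lookup-skip p i

  skip-injective : ∀ {y : A} {Y Y′} (p : Pick y Y Y′) {i j} → skip p i ≡ skip p j → i ≡ j
  skip-injective here      e                  = suc-injective e
  skip-injective (there p) {zero}  {zero}  e = refl
  skip-injective (there p) {suc i} {suc j} e = cong suc (skip-injective p (suc-injective e))

  skip≢pick-index : ∀ {y : A} {Y Y′} (p : Pick y Y Y′) i → skip p i ≢ pick-index p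
  skip≢pick-index (there p) (suc i) e = skip≢pick-index p i (suc-injective e)

  skip-surjective : ∀ {y : A} {Y Y′} (p : Pick y Y Y′) i → i ≢ pick-index p → ∃ λ i′ → skip p i′ ≡ i
  skip-surjective here      zero    i≢ = ⊥-elim (i≢ refl)
  skip-surjective here      (suc i) i≢ = i , refl
  skip-surjective (there p) zero    i≢ = zero , refl
  skip-surjective (there p) (suc i) i≢ with skip-surjective p i (i≢ ∘ cong suc)
  ... | i′ , e = suc i′ , cong suc e

  pick-at : (Y : List A) (j : Fin (length Y)) → Σ (Pick (lookup Y j) Y (removeAt Y j)) λ p → pick-index p ≡ j
  pick-at (y ∷ Y) zero    = here , refl
  pick-at (y ∷ Y) (suc j) with pick-at Y j
  ... | p , e = there p , cong suc e

module _ {A : Set} {R : Rel A 0ℓ} where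

  emb⇒indexEmb : ∀ {X Y} → Emb R X Y → IndexEmb R X Y
  emb⇒indexEmb [] = (λ ()) , (λ { {()} }) , (λ ())
  emb⇒indexEmb {x ∷ X} {Y} (cons r p e) with emb⇒indexEmb e
  ... | h , h-inj , h-R = h′ , h′-inj , h′-R
    where
    h′ : Fin (length (x ∷ X)) → Fin (length Y)
    h′ zero    = pick-index p
    h′ (suc a) = skip p (h a)
    h′-inj : ∀ {a b} → h′ a ≡ h′ b → a ≡ b
    h′-inj {zero}  {zero}  _ = refl
    h′-inj {zero}  {suc b} e = ⊥-elim (skip≢pick-index p (h b) (sym e))
    h′-inj {suc a} {zero}  e = ⊥-elim (skip≢pick-index p (h a) e)
    h′-inj {suc a} {suc b} e = cong suc (h-inj (skip-injective p e))
    h′-R : ∀ a → R (lookup (x ∷ X) a) (lookup Y (h′ a))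
    h′-R zero    = subst (R x) (sym (lookup-pick-index p)) r
    h′-R (suc a) = subst (R (lookup X a)) (sym (lookup-skip p (h a))) (h-R a)

  indexEmb⇒emb : ∀ X Y → IndexEmb R X Y → Emb R X Y
  indexEmb⇒emb []      Y _                 = []
  indexEmb⇒emb (x ∷ X) Y (h , h-inj , h-R) with pick-at Y (h zero)
  ... | p , p≡h0 = cons (h-R zero) p (indexEmb⇒emb X (removeAt Y (h zero)) (h′ , h′-inj , h′-R))
    where
    other : ∀ a → h (suc a) ≢ pick-index p
    other a e with h-inj (trans e p≡h0)
    ... | ()
    h′ : Fin (length X) → Fin (length (removeAt Y (h zero)))
    h′ a = proj₁ (skip-surjective p (h (suc a)) (other a))
    skip-h′ : ∀ a → skip p (h′ a) ≡ h (suc a)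
    skip-h′ a = proj₂ (skip-surjective p (h (suc a)) (other a))
    open ≡-Reasoning
    h′-inj : ∀ {a b} → h′ a ≡ h′ b → a ≡ b
    h′-inj {a} {b} e = suc-injective (h-inj (begin
      h (suc a)     ≡⟨ skip-h′ a ⟨
      skip p (h′ a) ≡⟨ cong (skip p) e ⟩
      skip p (h′ b) ≡⟨ skip-h′ b ⟩
      h (suc b)     ∎))
    lookup-h′ : ∀ a → lookup Y (h (suc a)) ≡ lookup (removeAt Y (h zero)) (h′ a)
    lookup-h′ a = begin
      lookup Y (h (suc a))                ≡⟨ cong (lookup Y) (skip-h′ a) ⟨
      lookup Y (skip p (h′ a))            ≡⟨ lookup-skip p (h′ a) ⟩
      lookup (removeAt Y (h zero)) (h′ a) ∎
    h′-R : ∀ a → R (lookup X a) (lookup (removeAt Y (h zero)) (h′ a))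
    h′-R a = subst (R (lookup X a)) (lookup-h′ a) (h-R (suc a))

module Coverability
  {C : Set} {_≼_ : Rel C 0ℓ}
  (≼-refl : Reflexive _≼_) (≼-trans : Transitive _≼_) (_≼?_ : Decidable _≼_) (≼-af : AF _≼_)
  {_⟶_ : Rel C 0ℓ}
  (⟶-mono : ∀ {x x′ y} → x ≼ x′ → x ⟶ y → ∃[ y′ ] x′ ⟶ y′ × y ≼ y′)
  (pre : C → List C)
  (pre-sound : ∀ b → All (λ x → ∃[ y ] x ⟶ y × b ≼ y) (pre b))
  (pre-complete : ∀ {x y} b → x ⟶ y → b ≼ y → Any (_≼ x) (pre b))
  where

  Coverable : C → C → Set
  Coverable c x = ∃[ y ] Star _⟶_ x y × c ≼ y

  Above : List C → C → Set
  Above B x = Any (_≼ x) B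

  above? : ∀ B x → Dec (Above B x)
  above? B x = any? (_≼? x) B

  ⟶*-mono : ∀ {x x′ y} → x ≼ x′ → Star _⟶_ x y → ∃[ y′ ] Star _⟶_ x′ y′ × y ≼ y′
  ⟶*-mono x≼x′ ε = _ , ε , x≼x′
  ⟶*-mono x≼x′ (step ◅ steps) with ⟶-mono x≼x′ step
  ... | _ , step′ , y≼y′ with ⟶*-mono y≼y′ steps
  ...   | _ , steps′ , z≼z′ = _ , step′ ◅ steps′ , z≼z′

  coverable-up : ∀ {c x x′} → x ≼ x′ → Coverable c x → Coverable c x′
  coverable-up x≼x′ (y , steps , c≼y) with ⟶*-mono x≼x′ steps
  ... | y′ , steps′ , y≼y′ = y′ , steps′ , ≼-trans c≼y y≼y′

  coverable-pre : ∀ {c x y b} → x ⟶ y → b ≼ y → Coverable c b → Coverable c x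
  coverable-pre step b≼y cov-b with coverable-up b≼y cov-b
  ... | z , steps , c≼z = z , step ◅ steps , c≼z

  above⇒coverable : ∀ {c B x} → All (Coverable c) B → Above B x → Coverable c x
  above⇒coverable cov-B b≼x with lookupAny cov-B b≼x
  ... | cov-b , b≼x′ = coverable-up b≼x′ cov-b

  Closed : List C → Set
  Closed B = All (λ b → All (Above B) (pre b)) B

  closed? : ∀ B → Dec (Closed B)
  closed? B = all? (λ b → all? (above? B) (pre b)) B

  closed-pre : ∀ {B x y} → Closed B → Above B y → x ⟶ y → Above B x
  closed-pre closed b≼y step with lookupAny closed b≼y
  ... | pre-b-above , b≼y′ with lookupAny pre-b-above (pre-complete _ step b≼y′)
  ...   | p-above , p≼x = Any.map (λ a≼p → ≼-trans a≼p p≼x) p-above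

  closed-pre* : ∀ {c B x y} → Closed B → Above B c → Star _⟶_ x y → c ≼ y → Above B x
  closed-pre* closed c-above ε              c≼y = Any.map (λ b≼c → ≼-trans b≼c c≼y) c-above
  closed-pre* closed c-above (step ◅ steps) c≼y =
    closed-pre closed (closed-pre* closed c-above steps c≼y) step

  uncovered-pre : ∀ {c B} → All (Coverable c) B → ¬ Closed B → ∃[ p ] ¬ Above B p × Coverable c p
  uncovered-pre {B = B} cov-B ¬closed
    with lookupAny cov-B (¬All⇒Any¬ (λ b → all? (above? B) (pre b)) B ¬closed)
  ... | cov-b , ¬pre-b-above with lookupAny (pre-sound _) (¬All⇒Any¬ (above? B) _ ¬pre-b-above)
  ...   | (y , step , b≼y) , ¬p-above = _ , ¬p-above , coverable-pre step b≼y cov-b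

  data BadExtension : Rel (List C) 0ℓ where
    extend : ∀ {p B} → ¬ Above B p → BadExtension (p ∷ B) B

  af⇒acc : ∀ {T : Rel C 0ℓ} {B} → AF T → (∀ {y z} → T y z → y ≼ z ⊎ Above B y) →
           Acc BadExtension B
  af⇒acc (now f) T⇒ = acc λ { (extend ¬p-above) → acc λ { (extend ¬q-above) →
    [ (λ p≼q → ⊥-elim (¬q-above (here p≼q))) , (λ p-above → ⊥-elim (¬p-above p-above)) ]′
      (T⇒ (f _ _)) } }
  af⇒acc {T} {B} (later g) T⇒ = acc λ { (extend ¬p-above) → af⇒acc (g _) (T↑⇒ ¬p-above) }
    where
    T↑⇒ : ∀ {p} → ¬ Above B p → ∀ {y z} → (T ↑ p) y z → y ≼ z ⊎ Above (p ∷ B) y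
    T↑⇒ ¬p-above (inj₁ t) = [ inj₁ , (λ y-above → inj₂ (there y-above)) ]′ (T⇒ t)
    T↑⇒ ¬p-above (inj₂ t) =
      [ (λ p≼y → inj₂ (here p≼y)) , (λ p-above → ⊥-elim (¬p-above p-above)) ]′ (T⇒ t)

  saturate : ∀ {c} B → Acc BadExtension B → All (Coverable c) B → Above B c →
             ∃[ B′ ] All (Coverable c) B′ × Closed B′ × Above B′ c
  saturate B (acc rs) cov-B c-above with closed? B
  ... | yes closed = B , cov-B , closed , c-above
  ... | no ¬closed with uncovered-pre cov-B ¬closed
  ...   | p , ¬p-above , cov-p =
    saturate (p ∷ B) (rs (extend ¬p-above)) (cov-p ∷ cov-B) (there c-above)

  coverable-basis : ∀ c → ∃[ B ] ∀ x → Coverable c x ⇔ Above B x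
  coverable-basis c with saturate (c ∷ []) (acc-inverse (af⇒acc ≼-af inj₁) (extend λ ()))
                                 ((c , ε , ≼-refl) ∷ []) (here ≼-refl)
  ... | B , cov-B , closed , c-above =
    B , λ x → mk⇔ (λ (_ , steps , c≼y) → closed-pre* closed c-above steps c≼y)
                  (above⇒coverable cov-B)

  coverable? : ∀ c x → Dec (Coverable c x)
  coverable? c x with coverable-basis c
  ... | B , basis = Dec.map (⇔.sym (basis x)) (above? B x)

when : ∀ {A P : Set} → Dec P → List A → List A
when (yes _) xs = xs
when (no _)  _  = []

module _ {A : Set} {Q : A → Set} where

  All-when : ∀ {P : Set} (p? : Dec P) {xs} → (P → All Q xs) → All Q (when p? xs)
  All-when (yes p) all = all p
  All-when (no _)  _   = []

  Any-when : ∀ {P : Set} (p? : Dec P) {xs} → P → Any Q xs → Any Q (when p? xs)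
  Any-when (yes _) _ any = any
  Any-when (no ¬p) p _   = ⊥-elim (¬p p)

  All-concatMap⁺ : ∀ {B : Set} {f : B → List A} {xs} → (∀ {t} → t ∈ xs → All Q (f t)) →
                   All Q (concatMap f xs)
  All-concatMap⁺ all = All.concat⁺ (All.map⁺ (All.tabulate all))

module _ {A : Set} where

  picks : (Y : List A) → List (∃₂ λ y Y′ → Pick y Y Y′)
  picks []      = []
  picks (y ∷ Y) = (y , Y , here) ∷ map (λ (z , Z , p) → z , y ∷ Z , there p) (picks Y)

  ∈-picks : ∀ {y : A} {Y Y′} (p : Pick y Y Y′) → (y , Y′ , p) ∈ picks Y
  ∈-picks here      = here refl
  ∈-picks (there p) = there (∈-map⁺ _ (∈-picks p))

-- The order of the paper, with the injection between multisets replaced by Emb.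
_≼_ : ∀ {n d} → Rel (Cfg n d) 0ℓ
_≼_ {d = zero}  p       q         = p ≡ q
_≼_ {d = suc d} (p , M) (p′ , M′) = p ≡ p′ × Emb (_≼_ {d = d}) M M′

module _ {n : ℕ} where

  ≼-refl : ∀ d → Reflexive (_≼_ {n} {d})
  ≼-refl zero    = refl
  ≼-refl (suc d) = refl , emb-refl (≼-refl d)

  ≼-trans : ∀ d → Transitive (_≼_ {n} {d})
  ≼-trans zero    = trans
  ≼-trans (suc d) (p≡ , m) (p≡′ , m′) = trans p≡ p≡′ , emb-trans (≼-trans d) m m′

  ≼-dec : ∀ d → Decidable (_≼_ {n} {d})
  ≼-dec zero    p       q         = p ≟ q
  ≼-dec (suc d) (p , M) (p′ , M′) = (p ≟ p′) ×-dec emb? (≼-dec d) M M′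

  ≼-af : ∀ d → AF (_≼_ {n} {d})
  ≼-af zero    = af-Fin n
  ≼-af (suc d) = af-∩ (af-on proj₁ (af-Fin n)) (af-on proj₂ (af-Emb (≼-dec d) (≼-af d)))

  ≼⇒⪯ : ∀ d {x y : Cfg n d} → x ≼ y → x ⪯ y
  ≼⇒⪯ zero    x≡y      = x≡y
  ≼⇒⪯ (suc d) (p≡ , m) with emb⇒indexEmb m
  ... | h , h-inj , h-≼ = p≡ , h , h-inj , λ a → ≼⇒⪯ d (h-≼ a)

  ⪯⇒≼ : ∀ d {x y : Cfg n d} → x ⪯ y → x ≼ y
  ⪯⇒≼ zero    x≡y = x≡y
  ⪯⇒≼ (suc d) {_ , M} {_ , M′} (p≡ , h , h-inj , h-⪯) =
    p≡ , indexEmb⇒emb M M′ (h , h-inj , λ a → ⪯⇒≼ d (h-⪯ a))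

  fire-mono : ∀ d {ls r} {x x′ y : Cfg n d} → x ≼ x′ → Fire d ls r x y →
              ∃[ y′ ] Fire d ls r x′ y′ × y ≼ y′
  fire-mono zero    refl       leaf = _ , leaf , refl
  fire-mono (suc d) (refl , m) add  = _ , add , refl , cons (≼-refl d) here m
  fire-mono (suc d) (refl , m) (down {xs = xs} f) with emb-pick m (pick-++ xs)
  ... | _ , _ , p , e≼z , m′ with fire-mono d e≼z f | pick⇒++ p
  ...   | _ , f′ , e′≼z′ | as , _ , refl , refl =
    _ , down {xs = as} f′ , refl , emb-insert (pick-++ xs) e′≼z′ (pick-++ as) m′

  enablers : ∀ d → List (Fin n) → List (Cfg n d)
  enablers zero    (q ∷ [])      = q ∷ []
  enablers (suc d) (q ∷ [])      = (q , []) ∷ []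
  enablers (suc d) (q ∷ q₁ ∷ ls) = map (λ e → q , e ∷ []) (enablers d (q₁ ∷ ls))
  enablers _       _             = []

  enablers-sound : ∀ d ls r → All (λ x → ∃ (Fire d ls r x)) (enablers d ls)
  enablers-sound zero    (q ∷ [])      (q′ ∷ []) = (_ , leaf) ∷ []
  enablers-sound (suc d) (q ∷ [])      (q′ ∷ r)  = (_ , add) ∷ []
  enablers-sound (suc d) (q ∷ q₁ ∷ ls) (q′ ∷ r)  =
    All.map⁺ (All.map (λ (_ , f) → _ , down {xs = []} {ys = []} f) (enablers-sound d (q₁ ∷ ls) r))
  enablers-sound zero    []            _         = []
  enablers-sound zero    (_ ∷ _ ∷ _)   _         = []
  enablers-sound (suc d) []            _         = []

  enablers-complete : ∀ d {ls r} {x y : Cfg n d} → Fire d ls r x y → Any (_≼ x) (enablers d ls)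
  enablers-complete zero    leaf               = here refl
  enablers-complete (suc d) add                = here (refl , [])
  enablers-complete (suc d) (down {xs = xs} f) =
    Any.map⁺ (Any.map (λ e₀≼e → refl , cons e₀≼e (pick-++ xs) []) (enablers-complete d f))

  -- A finite basis of the configurations from which the transition reaches ↑b:
  -- the element created by the transition, or the one its chain descends into,
  -- either covers some element β of the multiset of b or covers none of them.
  preFire : ∀ d → List (Fin n) → Vec (Fin n) (suc d) → Cfg n d → List (Cfg n d)
  preFire zero    (q ∷ [])      (q′ ∷ []) b       = when (b ≟ q′) (q ∷ [])
  preFire (suc d) (q ∷ [])      (q′ ∷ r)  (b , B) = when (b ≟ q′)
    ((q , B) ∷ concatMap (λ (β , L , _) → when (≼-dec d β (chain d r)) ((q , L) ∷ [])) (picks B))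
  preFire (suc d) (q ∷ q₁ ∷ ls) (q′ ∷ r)  (b , B) = when (b ≟ q′)
    (map (λ e → q , e ∷ B) (enablers d (q₁ ∷ ls)) ++
     concatMap (λ (β , L , _) → map (λ e → q , e ∷ L) (preFire d (q₁ ∷ ls) r β)) (picks B))
  preFire _       _             _         _       = []

  preFire-sound : ∀ d ls r b → All (λ x → ∃[ y ] Fire d ls r x y × b ≼ y) (preFire d ls r b)
  preFire-sound zero (q ∷ []) (q′ ∷ []) b = All-when (b ≟ q′) λ b≡q′ → (_ , leaf , b≡q′) ∷ []
  preFire-sound (suc d) (q ∷ []) (q′ ∷ r) (b , B) = All-when (b ≟ q′) λ b≡q′ →
    (_ , add , b≡q′ , emb-skip (emb-refl (≼-refl d))) ∷
    All-concatMap⁺ {xs = picks B} λ { {β , L , p} _ → All-when (≼-dec d β (chain d r)) λ β≼ →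
      (_ , add , b≡q′ , emb-insert p β≼ here (emb-refl (≼-refl d))) ∷ [] }
  preFire-sound (suc d) (q ∷ q₁ ∷ ls) (q′ ∷ r) (b , B) = All-when (b ≟ q′) λ b≡q′ →
    All.++⁺
      (All.map⁺ (All.map (λ (_ , f) → _ , down {xs = []} f , b≡q′ , emb-skip (emb-refl (≼-refl d)))
                         (enablers-sound d (q₁ ∷ ls) r)))
      (All-concatMap⁺ {xs = picks B} λ { {β , L , p} _ → All.map⁺ (All.map
        (λ (_ , f , β≼e′) → _ , down {xs = []} f , b≡q′ , emb-insert p β≼e′ here (emb-refl (≼-refl d)))
        (preFire-sound d (q₁ ∷ ls) r β)) })
  preFire-sound zero    []          _ _ = []
  preFire-sound zero    (_ ∷ _ ∷ _) _ _ = []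
  preFire-sound (suc d) []          _ _ = []

  preFire-complete : ∀ d {ls r} {x y : Cfg n d} b → Fire d ls r x y → b ≼ y →
                     Any (_≼ x) (preFire d ls r b)
  preFire-complete zero b (leaf {q' = q′}) b≡q′ = Any-when (b ≟ q′) b≡q′ (here refl)
  preFire-complete (suc d) (b , B) (add {q' = q′} {r = r}) (b≡q′ , m) with emb-split here m
  ... | inj₁ m′ = Any-when (b ≟ q′) b≡q′ (here (refl , m′))
  ... | inj₂ (β , _ , p , β≼ , m′) = Any-when (b ≟ q′) b≡q′ (there (Any.concatMap⁺ _
    (Any.map (λ { refl → Any-when (≼-dec d β (chain d r)) β≼ (here (refl , m′)) }) (∈-picks p))))
  preFire-complete (suc d) (b , B) (down {q' = q′} {xs = xs} f) (b≡q′ , m)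
    with emb-split (pick-++ xs) m
  ... | inj₁ m′ = Any-when (b ≟ q′) b≡q′ (Any.++⁺ˡ (Any.map⁺
    (Any.map (λ e₀≼e → refl , cons e₀≼e (pick-++ xs) m′) (enablers-complete d f))))
  ... | inj₂ (β , _ , p , β≼e′ , m′) = Any-when (b ≟ q′) b≡q′ (Any.++⁺ʳ _ (Any.concatMap⁺ _
    (Any.map (λ { refl → Any.map⁺ (Any.map (λ e₀≼e → refl , cons e₀≼e (pick-++ xs) m′)
                                           (preFire-complete d β f β≼e′)) }) (∈-picks p))))

module NMCSCoverability {k n : ℕ} (M : NMCS k n) where
  open NMCS M
  open Transition

  pre : Cfg n k → List (Cfg n k)
  pre b = concatMap (λ t → preFire k (toList (lhs t)) (rhs t) b) δ

  pre-sound : ∀ b → All (λ x → ∃[ y ] Step M x y × b ≼ y) (pre b)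
  pre-sound b = All-concatMap⁺ {xs = δ} λ {t} t∈δ →
    All.map (λ (y , f , b≼y) → y , (t , t∈δ , f) , b≼y) (preFire-sound k _ _ b)

  pre-complete : ∀ {x y} b → Step M x y → b ≼ y → Any (_≼ x) (pre b)
  pre-complete b (t , t∈δ , f) b≼y =
    Any.concatMap⁺ _ (Any.map (λ { refl → preFire-complete k b f b≼y }) t∈δ)

  step-mono : ∀ {x x′ y} → x ≼ x′ → Step M x y → ∃[ y′ ] Step M x′ y′ × y ≼ y′
  step-mono x≼x′ (t , t∈δ , f) with fire-mono k x≼x′ f
  ... | y′ , f′ , y≼y′ = y′ , (t , t∈δ , f′) , y≼y′

  open Coverability (≼-refl k) (≼-trans k) (≼-dec k) (≼-af k)
                    step-mono pre pre-sound pre-complete public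

lemma5 : (k n : ℕ) (M : NMCS k n) (c : Cfg n k) (q : Fin n) →
         Dec (Σ (Cfg n k) λ c' → c ⪯ c' × Reach M (init k q) c')
lemma5 k n M c q = Dec.map (mk⇔ (λ (y , steps , c≼y) → y , ≼⇒⪯ k c≼y , steps)
                                (λ (y , c⪯y , steps) → y , steps , ⪯⇒≼ k c⪯y))
                           (coverable? c (init k q))
  where open NMCSCoverability M
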